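{- Let $\mathbf{A}$ be a simple De Morgan monoid that is $0$-generated (i.e., has no proper subalgebra). Then $\mathbf{A}\cong\mathbf{2}$ or $\mathbf{A}\cong\mathbf{C}_4$ or $\mathbf{A}\cong\mathbf{D}_4$.
   Context: An involutive (commutative) residuated lattice (IRL) is an algebra $\langle A;\cdot,\wedge,\vee,\neg,e\rangle$ such that $\langle A;\cdot,e\rangle$ is a commutative monoid, $\langle A;\wedge,\vee\rangle$ is a lattice with order $\leqslant$, $\neg\neg x=x$, and $x\cdot y\leqslant z\iff \neg z\cdot y\leqslant\neg x$. Write $f:=\neg e$. A De Morgan monoid is an IRL with distributive lattice reduct satisfying $x\leqslant x\cdot x$. Subalgebras are in the full signature $\cdot,\wedge,\vee,\neg,e$. An algebra is simple if its congruence lattice has exactly two elements. $\mathbf{2}$: the two-element Boolean algebra on $\{f<e\}$ with $\cdot=\wedge$ and $\neg$ swapping $e,f$. $\mathbf{C}_4$: the chain $0<e<f<1$, $\neg$ swaps $0,1$ and $e,f$, $e$ neutral for $\cdot$, $0\cdot x=0$ for all $x$, $1\cdot x=1$ for $x\neq0$, $f\cdot f=1$. $\mathbf{D}_4$: the lattice with bottom $0$, top $1$, $e,f$ incomparable, $\neg$ swaps $0,1$ and $e,f$, $e$ neutral, $0\cdot x=0$, $1\cdot x=1$ for $x\neq0$, $f\cdot f=1$. -}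

module Defs where

open import Level using (0ℓ)
open import Data.Product using (Σ; ∃; _×_; _,_)
open import Data.Sum using (_⊎_)
open import Data.Empty using (⊥)
open import Relation.Binary.PropositionalEquality using (_≡_)
open import Function.Bundles using (_⇔_)

record RawIRL : Set₁ where
  infix 8 ~_
  infix 4 _≤_
  infixl 7 _·_
  infixr 6 _∧_
  infixr 5 _∨_
  field
    Carrier : Set
    _·_ : Carrier → Carrier → Carrier
    _∧_ : Carrier → Carrier → Carrier
    _∨_ : Carrier → Carrier → Carrier
    ~_  : Carrier → Carrier
    e   : Carrier

  _≤_ : Carrier → Carrier → Set
  x ≤ y = x ∧ y ≡ x

  f : Carrier
  f = ~ e

record IsIRL (A : RawIRL) : Set where
  open RawIRL A
  field
    ·-assoc  : ∀ x y z → (x · y) · z ≡ x · (y · z)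
    ·-comm   : ∀ x y → x · y ≡ y · x
    ·-identity : ∀ x → e · x ≡ x
    ∧-assoc  : ∀ x y z → (x ∧ y) ∧ z ≡ x ∧ (y ∧ z)
    ∧-comm   : ∀ x y → x ∧ y ≡ y ∧ x
    ∨-assoc  : ∀ x y z → (x ∨ y) ∨ z ≡ x ∨ (y ∨ z)
    ∨-comm   : ∀ x y → x ∨ y ≡ y ∨ x
    ∧-absorbs-∨ : ∀ x y → x ∧ (x ∨ y) ≡ x
    ∨-absorbs-∧ : ∀ x y → x ∨ (x ∧ y) ≡ x
    ¬-involutive : ∀ x → ~ (~ x) ≡ x
    residuation : ∀ x y z → (x · y ≤ z) ⇔ ((~ z) · y ≤ ~ x)

record IsDeMorganMonoid (A : RawIRL) : Set where
  open RawIRL A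
  field
    isIRL : IsIRL A
    distrib : ∀ x y z → x ∧ (y ∨ z) ≡ (x ∧ y) ∨ (x ∧ z)
    square-increasing : ∀ x → x ≤ x · x

record IsCongruence (A : RawIRL) (θ : RawIRL.Carrier A → RawIRL.Carrier A → Set) : Set where
  open RawIRL A
  field
    refl′  : ∀ x → θ x x
    sym′   : ∀ {x y} → θ x y → θ y x
    trans′ : ∀ {x y z} → θ x y → θ y z → θ x z
    ·-cong : ∀ {x y u v} → θ x y → θ u v → θ (x · u) (y · v)
    ∧-cong : ∀ {x y u v} → θ x y → θ u v → θ (x ∧ u) (y ∧ v)
    ∨-cong : ∀ {x y u v} → θ x y → θ u v → θ (x ∨ u) (y ∨ v)
    ¬-cong : ∀ {x y} → θ x y → θ (~ x) (~ y)

IsSimple : RawIRL → Set₁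
IsSimple A =
  (Σ Carrier λ x → Σ Carrier λ y → (x ≡ y → ⊥)) ×
  (∀ (θ : Carrier → Carrier → Set) → IsCongruence A θ →
     (∀ x y → θ x y → x ≡ y) ⊎ (∀ x y → θ x y))
  where open RawIRL A

record IsSubuniverse (A : RawIRL) (P : RawIRL.Carrier A → Set) : Set where
  open RawIRL A
  field
    e-closed : P e
    ·-closed : ∀ {x y} → P x → P y → P (x · y)
    ∧-closed : ∀ {x y} → P x → P y → P (x ∧ y)
    ∨-closed : ∀ {x y} → P x → P y → P (x ∨ y)
    ¬-closed : ∀ {x} → P x → P (~ x)

ZeroGenerated : RawIRL → Set₁
ZeroGenerated A =
  ∀ (P : RawIRL.Carrier A → Set) → IsSubuniverse A P → ∀ x → P x

record _≅_ (A B : RawIRL) : Set where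
  module A = RawIRL A
  module B = RawIRL B
  field
    to   : A.Carrier → B.Carrier
    from : B.Carrier → A.Carrier
    from-to : ∀ x → from (to x) ≡ x
    to-from : ∀ y → to (from y) ≡ y
    to-· : ∀ x y → to (x A.· y) ≡ to x B.· to y
    to-∧ : ∀ x y → to (x A.∧ y) ≡ to x B.∧ to y
    to-∨ : ∀ x y → to (x A.∨ y) ≡ to x B.∨ to y
    to-¬ : ∀ x → to (A.~ x) ≡ B.~ (to x)
    to-e : to A.e ≡ B.e

data Two : Set where
  f₂ e₂ : Two

∧₂ : Two → Two → Two
∧₂ e₂ y = y
∧₂ f₂ y = f₂

∨₂ : Two → Two → Two
∨₂ e₂ y = e₂
∨₂ f₂ y = y

¬₂ : Two → Two
¬₂ e₂ = f₂
¬₂ f₂ = e₂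

𝟚 : RawIRL
𝟚 = record { Carrier = Two ; _·_ = ∧₂ ; _∧_ = ∧₂ ; _∨_ = ∨₂ ; ~_ = ¬₂ ; e = e₂ }

data Four : Set where
  0₄ e₄ f₄ 1₄ : Four

¬₄ : Four → Four
¬₄ 0₄ = 1₄
¬₄ 1₄ = 0₄
¬₄ e₄ = f₄
¬₄ f₄ = e₄

·₄ : Four → Four → Four
·₄ 0₄ y  = 0₄
·₄ x  0₄ = 0₄
·₄ e₄ y  = y
·₄ x  e₄ = x
·₄ 1₄ y  = 1₄
·₄ f₄ 1₄ = 1₄
·₄ f₄ f₄ = 1₄

-- C4: the chain 0 < e < f < 1
rankC : Four → Four → Four
rankC 0₄ y = 0₄
rankC y 0₄ = 0₄
rankC 1₄ y = y
rankC y 1₄ = y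
rankC e₄ y = e₄
rankC f₄ y = y

∧C : Four → Four → Four
∧C = rankC

∨C : Four → Four → Four
∨C 1₄ y = 1₄
∨C y 1₄ = 1₄
∨C 0₄ y = y
∨C y 0₄ = y
∨C f₄ y = f₄
∨C e₄ y = y

C₄ : RawIRL
C₄ = record { Carrier = Four ; _·_ = ·₄ ; _∧_ = ∧C ; _∨_ = ∨C ; ~_ = ¬₄ ; e = e₄ }

-- D4: 0 < e, f < 1 with e, f incomparable
∧D : Four → Four → Four
∧D 0₄ y = 0₄
∧D 1₄ y = y
∧D e₄ 0₄ = 0₄
∧D e₄ e₄ = e₄
∧D e₄ f₄ = 0₄
∧D e₄ 1₄ = e₄
∧D f₄ 0₄ = 0₄
∧D f₄ e₄ = 0₄
∧D f₄ f₄ = f₄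
∧D f₄ 1₄ = f₄

∨D : Four → Four → Four
∨D 1₄ y = 1₄
∨D 0₄ y = y
∨D e₄ 0₄ = e₄
∨D e₄ e₄ = e₄
∨D e₄ f₄ = 1₄
∨D e₄ 1₄ = 1₄
∨D f₄ 0₄ = f₄
∨D f₄ e₄ = 1₄
∨D f₄ f₄ = f₄
∨D f₄ 1₄ = 1₄

D₄ : RawIRL
D₄ = record { Carrier = Four ; _·_ = ·₄ ; _∧_ = ∧D ; _∨_ = ∨D ; ~_ = ¬₄ ; e = e₄ }

module Submission where

open import Level using (0ℓ)
open import Data.Sum using (_⊎_; inj₁; inj₂)
open import Data.Product using (Σ; _×_; _,_; proj₁; proj₂)
open import Data.Empty using (⊥; ⊥-elim)
open import Function.Bundles using (Equivalence)
open import Relation.Binary.PropositionalEquality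
open import Algebra.Lattice.Bundles using (Lattice)
import Algebra.Lattice.Properties.Lattice as LatticeProperties
open import Relation.Binary.Lattice using (IsLattice)

open import Defs

-- The key fact is a dichotomy for negative idempotents: if a ≤ e and
-- a·a = a, then  x θ y :⇔ a·x ≤ y ∧ a·y ≤ x  is a congruence of any
-- involutive residuated lattice, and a θ e.  In a simple algebra θ is
-- therefore either the identity (so a = e) or total (so a is the least
-- element).  In a De Morgan monoid every a ≤ e is idempotent.
--
-- Apply this to the two negative elements ~(f·f) and e ∧ f.  Either
-- f·f = f, which forces f ≤ e, f least and A ⊇ 𝟚; or f·f is the greatest
-- element and, according to whether e ≤ f or e ∧ f is least, A contains
-- a copy of C₄ or of D₄ on {⊥, e, f, f·f}.  Finally, since A is
-- 0-generated, the image of any embedding into A is all of A, so the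
-- embedding is an isomorphism.

record IsHomomorphism (B A : RawIRL) (h : RawIRL.Carrier B → RawIRL.Carrier A) : Set where
  private
    module A = RawIRL A
    module B = RawIRL B
  field
    h-· : ∀ c d → h (c B.· d) ≡ h c A.· h d
    h-∧ : ∀ c d → h (c B.∧ d) ≡ h c A.∧ h d
    h-∨ : ∀ c d → h (c B.∨ d) ≡ h c A.∨ h d
    h-~ : ∀ c → h (B.~ c) ≡ A.~ (h c)
    h-e : h B.e ≡ A.e

record IsEmbedding (B A : RawIRL) (h : RawIRL.Carrier B → RawIRL.Carrier A) : Set where
  field
    isHomomorphism : IsHomomorphism B A h
    injective      : ∀ c d → h c ≡ h d → c ≡ d
  open IsHomomorphism isHomomorphism public

module _ {B A : RawIRL} where
  private
    module A = RawIRL A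
    module B = RawIRL B

  image-isSubuniverse : ∀ {h} → IsHomomorphism B A h →
                        IsSubuniverse A (λ x → Σ B.Carrier λ c → h c ≡ x)
  image-isSubuniverse hom = record
    { e-closed = B.e , h-e
    ; ·-closed = λ { (c , p) (d , q) → c B.· d , trans (h-· c d) (cong₂ A._·_ p q) }
    ; ∧-closed = λ { (c , p) (d , q) → c B.∧ d , trans (h-∧ c d) (cong₂ A._∧_ p q) }
    ; ∨-closed = λ { (c , p) (d , q) → c B.∨ d , trans (h-∨ c d) (cong₂ A._∨_ p q) }
    ; ¬-closed = λ { (c , p) → B.~ c , trans (h-~ c) (cong A.~_ p) }
    }
    where open IsHomomorphism hom

  -- An embedding into a 0-generated algebra is onto, hence an isomorphism.
  embedding⇒≅ : ZeroGenerated A → ∀ {h} → IsEmbedding B A h → A ≅ B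
  embedding⇒≅ zg {h} emb = record
    { to = to ; from = h ; from-to = h∘to ; to-from = λ c → to-reflects refl
    ; to-· = λ x y → to-reflects (trans (h-· _ _) (cong₂ A._·_ (h∘to x) (h∘to y)))
    ; to-∧ = λ x y → to-reflects (trans (h-∧ _ _) (cong₂ A._∧_ (h∘to x) (h∘to y)))
    ; to-∨ = λ x y → to-reflects (trans (h-∨ _ _) (cong₂ A._∨_ (h∘to x) (h∘to y)))
    ; to-¬ = λ x → to-reflects (trans (h-~ _) (cong A.~_ (h∘to x)))
    ; to-e = to-reflects h-e
    }
    where
    open IsEmbedding emb
    onto : ∀ x → Σ B.Carrier λ c → h c ≡ x
    onto = zg _ (image-isSubuniverse isHomomorphism)
    to : A.Carrier → B.Carrier
    to x = proj₁ (onto x)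
    h∘to : ∀ x → h (to x) ≡ x
    h∘to x = proj₂ (onto x)
    to-reflects : ∀ {x c} → h c ≡ x → to x ≡ c
    to-reflects p = injective _ _ (trans (h∘to _) (sym p))

module IRLProperties (A : RawIRL) (irl : IsIRL A) where
  open RawIRL A
  open IsIRL irl

  lattice : Lattice 0ℓ 0ℓ
  lattice = record
    { Carrier = Carrier ; _≈_ = _≡_ ; _∨_ = _∨_ ; _∧_ = _∧_
    ; isLattice = record
      { isEquivalence = isEquivalence
      ; ∨-comm = ∨-comm ; ∨-assoc = ∨-assoc ; ∨-cong = cong₂ _∨_
      ; ∧-comm = ∧-comm ; ∧-assoc = ∧-assoc ; ∧-cong = cong₂ _∧_
      ; absorptive = ∨-absorbs-∧ , ∧-absorbs-∨
      }
    }

  open LatticeProperties lattice public using (∧-idem)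

  -- The library orders a lattice by  x ≈ x ∧ y , the symmetric form of _≤_.
  private
    module Order = IsLattice (LatticeProperties.∨-∧-isOrderTheoreticLattice lattice)

  ≤-refl : ∀ x → x ≤ x
  ≤-refl = ∧-idem

  ≤-antisym : ∀ {x y} → x ≤ y → y ≤ x → x ≡ y
  ≤-antisym p q = Order.antisym (sym p) (sym q)

  ≤-trans : ∀ {x y z} → x ≤ y → y ≤ z → x ≤ z
  ≤-trans p q = sym (Order.trans (sym p) (sym q))

  x∧y≤x : ∀ x y → x ∧ y ≤ x
  x∧y≤x x y = sym (Order.x∧y≤x x y)

  x∧y≤y : ∀ x y → x ∧ y ≤ y
  x∧y≤y x y = sym (Order.x∧y≤y x y)

  ∧-greatest : ∀ {x y z} → x ≤ y → x ≤ z → x ≤ y ∧ z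
  ∧-greatest p q = sym (Order.∧-greatest (sym p) (sym q))

  x≤x∨y : ∀ x y → x ≤ x ∨ y
  x≤x∨y x y = sym (Order.x≤x∨y x y)

  y≤x∨y : ∀ x y → y ≤ x ∨ y
  y≤x∨y x y = sym (Order.y≤x∨y x y)

  ∨-least : ∀ {x y z} → x ≤ z → y ≤ z → x ∨ y ≤ z
  ∨-least p q = sym (Order.∨-least (sym p) (sym q))

  ≤⇒≡∧ˡ : ∀ {x y} → x ≤ y → x ≡ x ∧ y
  ≤⇒≡∧ˡ = sym

  ≤⇒≡∧ʳ : ∀ {x y} → y ≤ x → y ≡ x ∧ y
  ≤⇒≡∧ʳ {x} {y} p = sym (trans (∧-comm x y) p)

  ≤⇒≡∨ʳ : ∀ {x y} → x ≤ y → y ≡ x ∨ y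
  ≤⇒≡∨ʳ {x} {y} p = ≤-antisym (y≤x∨y x y) (∨-least p (≤-refl y))

  ≤⇒≡∨ˡ : ∀ {x y} → y ≤ x → x ≡ x ∨ y
  ≤⇒≡∨ˡ {x} {y} p = trans (≤⇒≡∨ʳ p) (∨-comm y x)

  ·-identityʳ : ∀ x → x · e ≡ x
  ·-identityʳ x = trans (·-comm x e) (·-identity x)

  residual⇒ : ∀ {x y z} → x · y ≤ z → ~ z · y ≤ ~ x
  residual⇒ {x} {y} {z} = Equivalence.to (residuation x y z)

  residual⇐ : ∀ {x y z} → ~ z · y ≤ ~ x → x · y ≤ z
  residual⇐ {x} {y} {z} = Equivalence.from (residuation x y z)

  ~-antitone : ∀ {x y} → x ≤ y → ~ y ≤ ~ x
  ~-antitone {x} {y} p =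
    subst (_≤ ~ x) (·-identityʳ (~ y))
      (residual⇒ (subst (_≤ y) (sym (·-identityʳ x)) p))

  ~-flipʳ : ∀ {x y} → x ≤ ~ y → y ≤ ~ x
  ~-flipʳ {x} {y} p = subst (_≤ ~ x) (¬-involutive y) (~-antitone p)

  ~-flipˡ : ∀ {x y} → ~ x ≤ y → ~ y ≤ x
  ~-flipˡ {x} {y} p = subst (~ y ≤_) (¬-involutive x) (~-antitone p)

  ~f≡e : ~ f ≡ e
  ~f≡e = ¬-involutive e

  ·-monoˡ : ∀ {x y z} → x ≤ y → x · z ≤ y · z
  ·-monoˡ {x} {y} {z} p = residual⇐ (≤-trans (residual⇒ (≤-refl (y · z))) (~-antitone p))

  ·-monoʳ : ∀ {x y z} → x ≤ y → z · x ≤ z · y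
  ·-monoʳ {x} {y} {z} p = subst₂ _≤_ (·-comm x z) (·-comm y z) (·-monoˡ p)

  ~-∨ : ∀ x y → ~ x ∧ ~ y ≤ ~ (x ∨ y)
  ~-∨ x y = ~-flipʳ (∨-least (~-flipʳ (x∧y≤x (~ x) (~ y))) (~-flipʳ (x∧y≤y (~ x) (~ y))))

  ·-∨-least : ∀ {a x y c} → a · x ≤ c → a · y ≤ c → a · (x ∨ y) ≤ c
  ·-∨-least {a} {x} {y} {c} p q =
    subst (_≤ c) (·-comm (x ∨ y) a)
      (residual⇐ (≤-trans (∧-greatest (residual⇒ (subst (_≤ c) (·-comm a x) p))
                                      (residual⇒ (subst (_≤ c) (·-comm a y) q)))
                          (~-∨ x y)))

  f·x≤f⇒x≤e : ∀ {x} → f · x ≤ f → x ≤ e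
  f·x≤f⇒x≤e {x} p = subst₂ _≤_ (trans (cong (_· x) ~f≡e) (·-identity x)) ~f≡e (residual⇒ p)

  IsBottom : Carrier → Set
  IsBottom b = ∀ y → b ≤ y

  IsTop : Carrier → Set
  IsTop t = ∀ y → y ≤ t

  ~-bottom : ∀ {b} → IsBottom b → IsTop (~ b)
  ~-bottom bot y = ~-flipʳ (bot (~ y))

  ~-top : ∀ {t} → IsTop t → IsBottom (~ t)
  ~-top top y = ~-flipˡ (top (~ y))

  bottom-annihilates : ∀ {b} → IsBottom b → ∀ x → b · x ≡ b
  bottom-annihilates {b} bot x = ≤-antisym (residual⇐ (~-bottom bot (~ b · x))) (bot (b · x))

  Degenerate : Set
  Degenerate = ∀ x y → x ≤ y

  bottom-top-degenerate : ∀ {b} → IsBottom b → IsTop b → Degenerate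
  bottom-top-degenerate bot top x y = ≤-trans (top x) (bot y)

  f-top-degenerate : IsTop f → Degenerate
  f-top-degenerate top x y =
    subst₂ _≤_ (trans (cong (_· x) ~f≡e) (·-identity x)) (¬-involutive y)
      (residual⇒ (top (~ y · x)))

  e-bottom-degenerate : IsBottom e → Degenerate
  e-bottom-degenerate bot = f-top-degenerate (~-bottom bot)

  -- A 0-generated nontrivial algebra has e ≠ f, since otherwise {e} is a
  -- subuniverse.
  zeroGenerated⇒e≢f : ZeroGenerated A → (Degenerate → ⊥) → e ≡ f → ⊥
  zeroGenerated⇒e≢f zg nontrivial e≡f =
    nontrivial λ x y → subst₂ _≤_ (sym (all-e x)) (sym (all-e y)) (≤-refl e)
    where
    singleton-e : IsSubuniverse A (_≡ e)
    singleton-e = record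
      { e-closed = refl
      ; ·-closed = λ p q → trans (cong₂ _·_ p q) (·-identity e)
      ; ∧-closed = λ p q → trans (cong₂ _∧_ p q) (∧-idem e)
      ; ∨-closed = λ p q → trans (cong₂ _∨_ p q) (sym (≤⇒≡∨ʳ (≤-refl e)))
      ; ¬-closed = λ p → trans (cong ~_ p) (sym e≡f)
      }
    all-e : ∀ x → x ≡ e
    all-e = zg _ singleton-e

  simple⇒nondegenerate : IsSimple A → Degenerate → ⊥
  simple⇒nondegenerate ((x , y , x≢y) , _) deg = x≢y (≤-antisym (deg x y) (deg y x))

-- The congruence of a negative idempotent

module NegativeIdempotent (A : RawIRL) (irl : IsIRL A)
                          (a : RawIRL.Carrier A) (a≤e : RawIRL._≤_ A a (RawIRL.e A))
                          (a·a≡a : RawIRL._·_ A a a ≡ a) where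
  open RawIRL A
  open IsIRL irl
  open IRLProperties A irl

  θ : Carrier → Carrier → Set
  θ x y = (a · x ≤ y) × (a · y ≤ x)

  private
    a·x≤x : ∀ x → a · x ≤ x
    a·x≤x x = subst (a · x ≤_) (·-identity x) (·-monoˡ a≤e)

    a·-idempotent : ∀ x → a · (a · x) ≡ a · x
    a·-idempotent x = trans (sym (·-assoc a a x)) (cong (_· x) a·a≡a)

    a·-distrib : ∀ x y → a · (x · y) ≡ (a · x) · (a · y)
    a·-distrib x y = begin
      a · (x · y)         ≡⟨ sym (a·-idempotent (x · y)) ⟩
      a · (a · (x · y))   ≡⟨ cong (a ·_) (sym (·-assoc a x y)) ⟩
      a · ((a · x) · y)   ≡⟨ cong (λ w → a · (w · y)) (·-comm a x) ⟩
      a · ((x · a) · y)   ≡⟨ cong (a ·_) (·-assoc x a y) ⟩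
      a · (x · (a · y))   ≡⟨ sym (·-assoc a x (a · y)) ⟩
      (a · x) · (a · y)   ∎
      where open ≡-Reasoning

    below-trans : ∀ {x y z} → a · x ≤ y → a · y ≤ z → a · x ≤ z
    below-trans {x} p q = subst (_≤ _) (a·-idempotent x) (≤-trans (·-monoʳ p) q)

    below-· : ∀ {x y u v} → a · x ≤ y → a · u ≤ v → a · (x · u) ≤ y · v
    below-· {x} {y} {u} {v} p q = subst (_≤ y · v) (sym (a·-distrib x u)) (≤-trans (·-monoˡ p) (·-monoʳ q))

    below-∧ : ∀ {x y u v} → a · x ≤ y → a · u ≤ v → a · (x ∧ u) ≤ y ∧ v
    below-∧ {x} {u = u} p q =
      ∧-greatest (≤-trans (·-monoʳ (x∧y≤x x u)) p) (≤-trans (·-monoʳ (x∧y≤y x u)) q)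

    below-∨ : ∀ {x y u v} → a · x ≤ y → a · u ≤ v → a · (x ∨ u) ≤ y ∨ v
    below-∨ {y = y} {v = v} p q = ·-∨-least (≤-trans p (x≤x∨y y v)) (≤-trans q (y≤x∨y y v))

    below-~ : ∀ {x y} → a · y ≤ x → a · ~ x ≤ ~ y
    below-~ {x} {y} p = subst (_≤ ~ y) (·-comm (~ x) a) (residual⇒ (subst (_≤ x) (·-comm a y) p))

  θ-isCongruence : IsCongruence A θ
  θ-isCongruence = record
    { refl′  = λ x → a·x≤x x , a·x≤x x
    ; sym′   = λ { (p , q) → q , p }
    ; trans′ = λ { (p , q) (p′ , q′) → below-trans p p′ , below-trans q′ q }
    ; ·-cong = λ { (p , q) (p′ , q′) → below-· p p′ , below-· q q′ }
    ; ∧-cong = λ { (p , q) (p′ , q′) → below-∧ p p′ , below-∧ q q′ }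
    ; ∨-cong = λ { (p , q) (p′ , q′) → below-∨ p p′ , below-∨ q q′ }
    ; ¬-cong = λ { (p , q) → below-~ q , below-~ p }
    }

  a-θ-e : θ a e
  a-θ-e = subst (_≤ e) (sym a·a≡a) a≤e , subst (_≤ a) (sym (·-identityʳ a)) (≤-refl a)

  simple⇒e-or-bottom : IsSimple A → (a ≡ e) ⊎ IsBottom a
  simple⇒e-or-bottom (_ , congruences) with congruences θ θ-isCongruence
  ... | inj₁ identity = inj₁ (identity a e a-θ-e)
  ... | inj₂ total    = inj₂ λ y → subst (_≤ y) a·a≡a (proj₁ (total a y))

module Classification (A : RawIRL) (dm : IsDeMorganMonoid A)
                      (simple : IsSimple A) (zg : ZeroGenerated A) where
  open RawIRL A
  open IsDeMorganMonoid dm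
  open IsIRL isIRL
  open IRLProperties A isIRL

  nondegenerate : Degenerate → ⊥
  nondegenerate = simple⇒nondegenerate simple

  e≢f : e ≡ f → ⊥
  e≢f = zeroGenerated⇒e≢f zg nondegenerate

  -- Every negative element of a De Morgan monoid is idempotent, hence e
  -- or the least element.
  negative-dichotomy : ∀ a → a ≤ e → (a ≡ e) ⊎ IsBottom a
  negative-dichotomy a a≤e = NegativeIdempotent.simple⇒e-or-bottom A isIRL a a≤e a·a≡a simple
    where
    a·a≡a : a · a ≡ a
    a·a≡a = ≤-antisym (subst (a · a ≤_) (·-identity a) (·-monoˡ a≤e)) (square-increasing a)

  T : Carrier
  T = f · f

  ~T≤e : ~ T ≤ e
  ~T≤e = ~-flipˡ (square-increasing f)

  T≡f⇒f≤e : T ≡ f → f ≤ e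
  T≡f⇒f≤e T≡f = f·x≤f⇒x≤e (subst (_≤ f) (sym T≡f) (≤-refl f))

  embedding-𝟚 : IsBottom f → IsEmbedding 𝟚 A λ { f₂ → f ; e₂ → e }
  embedding-𝟚 f-bot = record
    { isHomomorphism = record
      { h-· = λ { e₂ d → sym (·-identity _) ; f₂ d → sym (bottom-annihilates f-bot _) }
      ; h-∧ = λ { e₂ d → ≤⇒≡∧ʳ (e-top _) ; f₂ d → ≤⇒≡∧ˡ (f-bot _) }
      ; h-∨ = λ { e₂ d → ≤⇒≡∨ˡ (e-top _) ; f₂ d → ≤⇒≡∨ʳ (f-bot _) }
      ; h-~ = λ { e₂ → refl ; f₂ → sym ~f≡e }
      ; h-e = refl
      }
    ; injective = λ { f₂ f₂ _ → refl ; e₂ e₂ _ → refl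
                    ; f₂ e₂ p → ⊥-elim (e≢f (sym p)) ; e₂ f₂ p → ⊥-elim (e≢f p) }
    }
    where
    e-top : IsTop e
    e-top = subst IsTop ~f≡e (~-bottom f-bot)

  module FourElements (z : Carrier) (z-bot : IsBottom z) (T-top : IsTop T) where
    h : Four → Carrier
    h 0₄ = z
    h e₄ = e
    h f₄ = f
    h 1₄ = T

    private
      T·f≡T : T · f ≡ T
      T·f≡T = ≤-antisym (T-top _) (·-monoˡ (T-top f))

      T·T≡T : T · T ≡ T
      T·T≡T = ≤-antisym (T-top _) (square-increasing T)

      annihilatesʳ : ∀ x → x · z ≡ z
      annihilatesʳ x = trans (·-comm x z) (bottom-annihilates z-bot x)

    h-· : ∀ c d → h (·₄ c d) ≡ h c · h d
    h-· 0₄ d  = sym (bottom-annihilates z-bot (h d))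
    h-· e₄ 0₄ = sym (annihilatesʳ e)
    h-· f₄ 0₄ = sym (annihilatesʳ f)
    h-· 1₄ 0₄ = sym (annihilatesʳ T)
    h-· e₄ e₄ = sym (·-identity e)
    h-· e₄ f₄ = sym (·-identity f)
    h-· e₄ 1₄ = sym (·-identity T)
    h-· f₄ e₄ = sym (·-identityʳ f)
    h-· 1₄ e₄ = sym (·-identityʳ T)
    h-· f₄ f₄ = refl
    h-· f₄ 1₄ = sym (trans (·-comm f T) T·f≡T)
    h-· 1₄ f₄ = sym T·f≡T
    h-· 1₄ 1₄ = sym T·T≡T

    h-~ : ∀ c → h (¬₄ c) ≡ ~ (h c)
    h-~ 0₄ = ≤-antisym (~-bottom z-bot T) (T-top _)
    h-~ e₄ = refl
    h-~ f₄ = sym ~f≡e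
    h-~ 1₄ = ≤-antisym (z-bot _) (~-top T-top z)

    private
      z≢e : z ≡ e → ⊥
      z≢e z≡e = nondegenerate (e-bottom-degenerate (subst IsBottom z≡e z-bot))

      z≢f : z ≡ f → ⊥
      z≢f z≡f = nondegenerate (bottom-top-degenerate f-bot (subst IsTop f·f≡f T-top))
        where
        f-bot : IsBottom f
        f-bot = subst IsBottom z≡f z-bot
        f·f≡f : T ≡ f
        f·f≡f = bottom-annihilates f-bot f

      z≢T : z ≡ T → ⊥
      z≢T z≡T = nondegenerate (bottom-top-degenerate z-bot (subst IsTop (sym z≡T) T-top))

      -- e = f·f would give f ≤ e, hence f·f ≤ f, making f greatest.
      e≢T : e ≡ T → ⊥
      e≢T e≡T = nondegenerate (f-top-degenerate λ y → ≤-trans (T-top y) T≤f)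
        where
        T≤f : T ≤ f
        T≤f = subst (T ≤_) (·-identity f) (·-monoˡ (subst (f ≤_) (sym e≡T) (T-top f)))

      f≢T : f ≡ T → ⊥
      f≢T f≡T = nondegenerate (f-top-degenerate (subst IsTop (sym f≡T) T-top))

    injective : ∀ c d → h c ≡ h d → c ≡ d
    injective 0₄ 0₄ _ = refl
    injective e₄ e₄ _ = refl
    injective f₄ f₄ _ = refl
    injective 1₄ 1₄ _ = refl
    injective 0₄ e₄ p = ⊥-elim (z≢e p)
    injective 0₄ f₄ p = ⊥-elim (z≢f p)
    injective 0₄ 1₄ p = ⊥-elim (z≢T p)
    injective e₄ f₄ p = ⊥-elim (e≢f p)
    injective e₄ 1₄ p = ⊥-elim (e≢T p)
    injective f₄ 1₄ p = ⊥-elim (f≢T p)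
    injective e₄ 0₄ p = ⊥-elim (z≢e (sym p))
    injective f₄ 0₄ p = ⊥-elim (z≢f (sym p))
    injective 1₄ 0₄ p = ⊥-elim (z≢T (sym p))
    injective f₄ e₄ p = ⊥-elim (e≢f (sym p))
    injective 1₄ e₄ p = ⊥-elim (e≢T (sym p))
    injective 1₄ f₄ p = ⊥-elim (f≢T (sym p))

  embedding-C₄ : ∀ {z} (z-bot : IsBottom z) (T-top : IsTop T) → e ≤ f →
                 IsEmbedding C₄ A (FourElements.h z z-bot T-top)
  embedding-C₄ {z} z-bot T-top e≤f = record
    { isHomomorphism = record { h-· = h-· ; h-∧ = h-∧ ; h-∨ = h-∨ ; h-~ = h-~ ; h-e = refl }
    ; injective = injective
    }
    where
    open FourElements z z-bot T-top
    h-∧ : ∀ c d → h (∧C c d) ≡ h c ∧ h d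
    h-∧ 0₄ d  = ≤⇒≡∧ˡ (z-bot _)
    h-∧ e₄ 0₄ = ≤⇒≡∧ʳ (z-bot _)
    h-∧ f₄ 0₄ = ≤⇒≡∧ʳ (z-bot _)
    h-∧ 1₄ 0₄ = ≤⇒≡∧ʳ (z-bot _)
    h-∧ 1₄ e₄ = ≤⇒≡∧ʳ (T-top _)
    h-∧ 1₄ f₄ = ≤⇒≡∧ʳ (T-top _)
    h-∧ 1₄ 1₄ = ≤⇒≡∧ʳ (T-top _)
    h-∧ e₄ 1₄ = ≤⇒≡∧ˡ (T-top _)
    h-∧ f₄ 1₄ = ≤⇒≡∧ˡ (T-top _)
    h-∧ e₄ e₄ = ≤⇒≡∧ˡ (≤-refl _)
    h-∧ f₄ f₄ = ≤⇒≡∧ˡ (≤-refl _)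
    h-∧ e₄ f₄ = ≤⇒≡∧ˡ e≤f
    h-∧ f₄ e₄ = ≤⇒≡∧ʳ e≤f
    h-∨ : ∀ c d → h (∨C c d) ≡ h c ∨ h d
    h-∨ 1₄ d  = ≤⇒≡∨ˡ (T-top _)
    h-∨ 0₄ 1₄ = ≤⇒≡∨ʳ (T-top _)
    h-∨ e₄ 1₄ = ≤⇒≡∨ʳ (T-top _)
    h-∨ f₄ 1₄ = ≤⇒≡∨ʳ (T-top _)
    h-∨ 0₄ 0₄ = ≤⇒≡∨ʳ (z-bot _)
    h-∨ 0₄ e₄ = ≤⇒≡∨ʳ (z-bot _)
    h-∨ 0₄ f₄ = ≤⇒≡∨ʳ (z-bot _)
    h-∨ e₄ 0₄ = ≤⇒≡∨ˡ (z-bot _)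
    h-∨ f₄ 0₄ = ≤⇒≡∨ˡ (z-bot _)
    h-∨ e₄ e₄ = ≤⇒≡∨ʳ (≤-refl _)
    h-∨ f₄ f₄ = ≤⇒≡∨ʳ (≤-refl _)
    h-∨ e₄ f₄ = ≤⇒≡∨ʳ e≤f
    h-∨ f₄ e₄ = ≤⇒≡∨ˡ e≤f

  -- If instead e ∧ f is least, the four elements form the diamond D₄;
  -- by De Morgan duality e ∨ f is then greatest.
  embedding-D₄ : (e∧f-bot : IsBottom (e ∧ f)) (T-top : IsTop T) →
                 IsEmbedding D₄ A (FourElements.h (e ∧ f) e∧f-bot T-top)
  embedding-D₄ e∧f-bot T-top = record
    { isHomomorphism = record { h-· = h-· ; h-∧ = h-∧ ; h-∨ = h-∨ ; h-~ = h-~ ; h-e = refl }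
    ; injective = injective
    }
    where
    open FourElements (e ∧ f) e∧f-bot T-top
    ~[e∨f]-bot : IsBottom (~ (e ∨ f))
    ~[e∨f]-bot y =
      ≤-trans (∧-greatest (~-flipˡ (y≤x∨y e f)) (~-flipˡ (subst (_≤ e ∨ f) (sym ~f≡e) (x≤x∨y e f))))
              (e∧f-bot y)
    e∨f≡T : e ∨ f ≡ T
    e∨f≡T = ≤-antisym (T-top _) (subst IsTop (¬-involutive (e ∨ f)) (~-bottom ~[e∨f]-bot) T)
    h-∧ : ∀ c d → h (∧D c d) ≡ h c ∧ h d
    h-∧ 0₄ d  = ≤⇒≡∧ˡ (e∧f-bot _)
    h-∧ 1₄ d  = ≤⇒≡∧ʳ (T-top _)
    h-∧ e₄ 0₄ = ≤⇒≡∧ʳ (e∧f-bot _)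
    h-∧ f₄ 0₄ = ≤⇒≡∧ʳ (e∧f-bot _)
    h-∧ e₄ 1₄ = ≤⇒≡∧ˡ (T-top _)
    h-∧ f₄ 1₄ = ≤⇒≡∧ˡ (T-top _)
    h-∧ e₄ e₄ = ≤⇒≡∧ˡ (≤-refl _)
    h-∧ f₄ f₄ = ≤⇒≡∧ˡ (≤-refl _)
    h-∧ e₄ f₄ = refl
    h-∧ f₄ e₄ = ∧-comm e f
    h-∨ : ∀ c d → h (∨D c d) ≡ h c ∨ h d
    h-∨ 1₄ d  = ≤⇒≡∨ˡ (T-top _)
    h-∨ 0₄ d  = ≤⇒≡∨ʳ (e∧f-bot _)
    h-∨ e₄ 0₄ = ≤⇒≡∨ˡ (e∧f-bot _)
    h-∨ f₄ 0₄ = ≤⇒≡∨ˡ (e∧f-bot _)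
    h-∨ e₄ 1₄ = ≤⇒≡∨ʳ (T-top _)
    h-∨ f₄ 1₄ = ≤⇒≡∨ʳ (T-top _)
    h-∨ e₄ e₄ = ≤⇒≡∨ʳ (≤-refl _)
    h-∨ f₄ f₄ = ≤⇒≡∨ʳ (≤-refl _)
    h-∨ e₄ f₄ = sym e∨f≡T
    h-∨ f₄ e₄ = trans (sym e∨f≡T) (∨-comm e f)

theorem5p20 : (A : RawIRL) → IsDeMorganMonoid A → IsSimple A → ZeroGenerated A →
    (A ≅ 𝟚) ⊎ ((A ≅ C₄) ⊎ (A ≅ D₄))
theorem5p20 A dm simple zg =
  classify (negative-dichotomy (~ T) ~T≤e) (negative-dichotomy (e ∧ f) (x∧y≤x e f))
  where
  open RawIRL A
  open IsDeMorganMonoid dm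
  open IsIRL isIRL
  open IRLProperties A isIRL
  open Classification A dm simple zg

  T-top : IsBottom (~ T) → IsTop T
  T-top ~T-bot = subst IsTop (¬-involutive T) (~-bottom ~T-bot)

  -- ~T = e means f·f = f, so f ≤ e and e ∧ f = f.
  e∧f≡f : ~ T ≡ e → e ∧ f ≡ f
  e∧f≡f ~T≡e = trans (∧-comm e f) (T≡f⇒f≤e (trans (sym (¬-involutive T)) (cong ~_ ~T≡e)))

  classify : (~ T ≡ e) ⊎ IsBottom (~ T) → (e ∧ f ≡ e) ⊎ IsBottom (e ∧ f) →
             (A ≅ 𝟚) ⊎ ((A ≅ C₄) ⊎ (A ≅ D₄))
  classify (inj₁ ~T≡e) (inj₁ e∧f≡e) = ⊥-elim (e≢f (trans (sym e∧f≡e) (e∧f≡f ~T≡e)))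
  classify (inj₁ ~T≡e) (inj₂ e∧f-bot) =
    inj₁ (embedding⇒≅ zg (embedding-𝟚 (subst IsBottom (e∧f≡f ~T≡e) e∧f-bot)))
  classify (inj₂ ~T-bot) (inj₁ e≤f) =
    inj₂ (inj₁ (embedding⇒≅ zg (embedding-C₄ ~T-bot (T-top ~T-bot) e≤f)))
  classify (inj₂ ~T-bot) (inj₂ e∧f-bot) =
    inj₂ (inj₂ (embedding⇒≅ zg (embedding-D₄ e∧f-bot (T-top ~T-bot))))
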